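{- Let $C_n=\frac{1}{n+1}\binom{2n}{n}$ ($n\ge0$) be the Catalan numbers. Then for every $n\ge0$, $$C_{n+1}=\sum_{h=0}^n\binom{n}{h}(-1)^h4^{n-h}C_{h+1},$$ i.e., $L^{(-1,4)}(\sigma(C))=\sigma(C)$.
   Context: $\sigma$ is the shift operator $\sigma(a_0,a_1,a_2,\ldots)=(a_1,a_2,\ldots)$, and $L^{(h,y)}(a)=b$ with $b_n=\sum_{i=0}^n\binom{n}{i}h^iy^{n-i}a_i$. -}

module Defs where

open import Data.Nat as ℕ using (ℕ; zero; suc)
open import Data.Nat.DivMod using (_/_)
open import Data.Nat.Combinatorics using (_C_)
open import Data.Integer as ℤ using (ℤ; +_)

-- Catalan numbers C_n = (2n choose n) / (n+1)  (exact division in ℕ)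
catalan : ℕ → ℕ
catalan n = ((2 ℕ.* n) C n) / suc n

catalanℤ : ℕ → ℤ
catalanℤ n = + catalan n

sumTo : ℕ → (ℕ → ℤ) → ℤ
sumTo zero    f = f 0
sumTo (suc n) f = sumTo n f ℤ.+ f (suc n)

σ : (ℕ → ℤ) → (ℕ → ℤ)
σ a n = a (suc n)

L : ℤ → ℤ → (ℕ → ℤ) → (ℕ → ℤ)
L h y a n = sumTo n (λ i → + (n C i) ℤ.* (h ℤ.^ i) ℤ.* (y ℤ.^ (n ℕ.∸ i)) ℤ.* a i)

-- Both σ C and L^{(-1,4)}(σ C) satisfy (k + 3) a_{k+1} = (4k + 6) a_k and have the same initial
-- term, so they agree.  For a solution a, put β = L a and τ = L (σ a).  Pascal's rule gives
-- β_{n+1} = 4 β_n - τ_n, and L turns the recurrence, written with the Euler operator θ, into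
-- (n + 3) τ_n = 6 β_n; combining the two, β satisfies the recurrence again.
module Submission where

open import Defs
open import Data.Nat as ℕ using (ℕ; zero; suc; _∸_; s≤s)
import Data.Nat.Properties as ℕ
import Data.Nat.Tactic.RingSolver as ℕ-Solver
open import Data.Nat.Combinatorics using (_C_; nCk+nC[k+1]≡[n+1]C[k+1]; k>n⇒nCk≡0)
open import Relation.Binary.PropositionalEquality
open ≡-Reasoning

module CatalanNumbers where

  open import Data.Nat using (_+_; _*_)
  open import Data.Nat.Properties
  open import Data.Nat.Divisibility using (_∣_; ∣m+n∣m⇒∣n; m∣m*n)
  open import Data.Nat.DivMod using (m*[n/m]≡n)
  open import Data.Nat.Combinatorics using (nC1≡n)
  open import Data.Nat.Tactic.RingSolver using (solve-∀)

  C-absorb : ∀ n k → suc k * (suc n C suc k) ≡ suc n * (n C k)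
  C-absorb n       zero    =
    trans (*-identityˡ (suc n C 1)) (trans (nC1≡n (suc n)) (sym (*-identityʳ (suc n))))
  C-absorb zero    (suc k) = *-zeroʳ (2 + k)
  C-absorb (suc n) (suc k) = begin
    (2 + k) * (suc (suc n) C suc (suc k)) ≡⟨ cong ((2 + k) *_) (nCk+nC[k+1]≡[n+1]C[k+1] (suc n) (suc k)) ⟨
    (2 + k) * (a + b)                     ≡⟨ distrib-2+ k a b ⟩
    suc k * a + a + (2 + k) * b           ≡⟨ cong₂ (λ u v → u + a + v) (C-absorb n k) (C-absorb n (suc k)) ⟩
    suc n * p + a + suc n * q             ≡⟨ cong (λ u → suc n * p + u + suc n * q) (nCk+nC[k+1]≡[n+1]C[k+1] n k) ⟨
    suc n * p + (p + q) + suc n * q       ≡⟨ collect-2+ n p q ⟩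
    (2 + n) * (p + q)                     ≡⟨ cong ((2 + n) *_) (nCk+nC[k+1]≡[n+1]C[k+1] n k) ⟩
    (2 + n) * a                           ∎
    where
    a = suc n C suc k
    b = suc n C suc (suc k)
    p = n C k
    q = n C suc k
    distrib-2+ : ∀ k a b → (2 + k) * (a + b) ≡ suc k * a + a + (2 + k) * b
    distrib-2+ = solve-∀
    collect-2+ : ∀ n p q → suc n * p + (p + q) + suc n * q ≡ (2 + n) * (p + q)
    collect-2+ = solve-∀

  C-suc-ratio : ∀ k j → suc k * ((k + j) C suc k) ≡ j * ((k + j) C k)
  C-suc-ratio k j = +-cancelˡ-≡ (suc k * p) (suc k * q) (j * p) (begin
    suc k * p + suc k * q        ≡⟨ *-distribˡ-+ (suc k) p q ⟨
    suc k * (p + q)              ≡⟨ cong (suc k *_) (nCk+nC[k+1]≡[n+1]C[k+1] (k + j) k) ⟩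
    suc k * (suc (k + j) C suc k) ≡⟨ C-absorb (k + j) k ⟩
    suc (k + j) * p              ≡⟨ *-distribʳ-+ p (suc k) j ⟩
    suc k * p + j * p            ∎)
    where
    p = (k + j) C k
    q = (k + j) C suc k

  2*n≡n+n : ∀ n → 2 * n ≡ n + n
  2*n≡n+n n = cong (n +_) (+-identityʳ n)

  central-C-suc : ∀ n → suc n * ((2 * n) C suc n) ≡ n * ((2 * n) C n)
  central-C-suc n = subst (λ m → suc n * (m C suc n) ≡ n * (m C n)) (sym (2*n≡n+n n)) (C-suc-ratio n n)

  suc-∣-central : ∀ n → suc n ∣ (2 * n) C n
  suc-∣-central n = ∣m+n∣m⇒∣n
    (subst (suc n ∣_) (+-comm B (n * B)) (m∣m*n B))
    (subst (suc n ∣_) (central-C-suc n) (m∣m*n ((2 * n) C suc n)))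
    where B = (2 * n) C n

  catalan-central : ∀ n → suc n * catalan n ≡ (2 * n) C n
  catalan-central n = m*[n/m]≡n (suc-∣-central n)

  odd-C-sym : ∀ n → suc (2 * n) C n ≡ suc (2 * n) C suc n
  odd-C-sym n = sym (*-cancelˡ-≡ _ _ (suc n)
    (subst (λ m → suc n * (m C suc n) ≡ suc n * (m C n)) n+suc-n (C-suc-ratio n (suc n))))
    where
    n+suc-n : n + suc n ≡ suc (2 * n)
    n+suc-n = trans (+-suc n n) (cong suc (sym (2*n≡n+n n)))

  catalan-suc : ∀ n → (2 + n) * catalan (suc n) ≡ (2 + 4 * n) * catalan n
  catalan-suc n = *-cancelˡ-≡ _ _ (suc n) (begin
    suc n * ((2 + n) * catalan (suc n))   ≡⟨ cong (suc n *_) (catalan-central (suc n)) ⟩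
    suc n * ((2 * suc n) C suc n)         ≡⟨ cong (λ m → suc n * (m C suc n)) (2*suc-n n) ⟩
    suc n * ((2 + 2 * n) C suc n)         ≡⟨ C-absorb (suc (2 * n)) n ⟩
    (2 + 2 * n) * (suc (2 * n) C n)       ≡⟨ cong ((2 + 2 * n) *_) (odd-C-sym n) ⟩
    (2 + 2 * n) * (suc (2 * n) C suc n)   ≡⟨ double-suc n (suc (2 * n) C suc n) ⟩
    2 * (suc n * (suc (2 * n) C suc n))   ≡⟨ cong (2 *_) (C-absorb (2 * n) n) ⟩
    2 * (suc (2 * n) * ((2 * n) C n))     ≡⟨ cong (λ x → 2 * (suc (2 * n) * x)) (catalan-central n) ⟨
    2 * (suc (2 * n) * (suc n * catalan n)) ≡⟨ regroup n (catalan n) ⟩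
    suc n * ((2 + 4 * n) * catalan n)     ∎)
    where
    2*suc-n : ∀ n → 2 * suc n ≡ 2 + 2 * n
    2*suc-n = solve-∀
    double-suc : ∀ n x → (2 + 2 * n) * x ≡ 2 * (suc n * x)
    double-suc = solve-∀
    regroup : ∀ n c → 2 * (suc (2 * n) * (suc n * c)) ≡ suc n * ((2 + 4 * n) * c)
    regroup = solve-∀

open CatalanNumbers using (C-absorb; catalan-suc)

open import Data.Integer using (ℤ; +_; -[1+_]; _+_; _*_; _^_; 0ℤ; 1ℤ)
open import Data.Integer.Properties
  using (+-identityˡ; +-identityʳ; +-assoc; *-identityˡ; *-zeroʳ; *-distribˡ-+; *-cancelˡ-≡; pos-*)
open import Data.Integer.Tactic.RingSolver using (solve-∀)
open import Function using (_∘_)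
open import Relation.Nullary using (yes; no)

sumTo-cong : ∀ n {f g : ℕ → ℤ} → (∀ i → f i ≡ g i) → sumTo n f ≡ sumTo n g
sumTo-cong zero    f≗g = f≗g 0
sumTo-cong (suc n) f≗g = cong₂ _+_ (sumTo-cong n f≗g) (f≗g (suc n))

sumTo-+ : ∀ n (f g : ℕ → ℤ) → sumTo n (λ i → f i + g i) ≡ sumTo n f + sumTo n g
sumTo-+ zero    f g = refl
sumTo-+ (suc n) f g = trans (cong (_+ (f (suc n) + g (suc n))) (sumTo-+ n f g))
                            (interchange (sumTo n f) (sumTo n g) (f (suc n)) (g (suc n)))
  where
  interchange : ∀ a b c d → a + b + (c + d) ≡ a + c + (b + d)
  interchange = solve-∀

sumTo-* : ∀ n c (f : ℕ → ℤ) → sumTo n (λ i → c * f i) ≡ c * sumTo n f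
sumTo-* zero    c f = refl
sumTo-* (suc n) c f = trans (cong (_+ c * f (suc n)) (sumTo-* n c f)) (sym (*-distribˡ-+ c (sumTo n f) (f (suc n))))

sumTo-suc : ∀ n (f : ℕ → ℤ) → sumTo (suc n) f ≡ f 0 + sumTo n (f ∘ suc)
sumTo-suc zero    f = refl
sumTo-suc (suc n) f = trans (cong (_+ f (2 ℕ.+ n)) (sumTo-suc n f)) (+-assoc (f 0) (sumTo n (f ∘ suc)) (f (2 ℕ.+ n)))

L-term : ℤ → ℤ → (ℕ → ℤ) → ℕ → ℕ → ℤ
L-term h y a n i = + (n C i) * h ^ i * y ^ (n ∸ i) * a i

L-zero : ∀ h y a → L h y a 0 ≡ a 0
L-zero h y a = *-identityˡ (a 0)

L-cong : ∀ h y {a b : ℕ → ℤ} n → (∀ k → a k ≡ b k) → L h y a n ≡ L h y b n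
L-cong h y n a≗b = sumTo-cong n (λ i → cong (+ (n C i) * h ^ i * y ^ (n ∸ i) *_) (a≗b i))

L-+ : ∀ h y (a b : ℕ → ℤ) n → L h y (λ k → a k + b k) n ≡ L h y a n + L h y b n
L-+ h y a b n = trans (sumTo-cong n (λ i → *-distribˡ-+ (+ (n C i) * h ^ i * y ^ (n ∸ i)) (a i) (b i)))
                      (sumTo-+ n (L-term h y a n) (L-term h y b n))

L-* : ∀ h y c (a : ℕ → ℤ) n → L h y (λ k → c * a k) n ≡ c * L h y a n
L-* h y c a n = trans (sumTo-cong n (λ i → pull (+ (n C i) * h ^ i * y ^ (n ∸ i)) c (a i)))
                      (sumTo-* n c (L-term h y a n))
  where
  pull : ∀ x c z → x * (c * z) ≡ c * (x * z)
  pull = solve-∀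

-- Either the binomial vanishes or the exponent n ∸ j is positive.
C-suc-*-^∸ : ∀ n j (y : ℤ) → + (n C suc j) * y ^ (n ∸ j) ≡ + (n C suc j) * (y * y ^ (n ∸ suc j))
C-suc-*-^∸ n j y with j ℕ.<? n
... | yes j<n = cong (λ e → + (n C suc j) * y ^ e) (ℕ.+-∸-assoc 1 j<n)
... | no  j≮n rewrite k>n⇒nCk≡0 (s≤s (ℕ.≮⇒≥ j≮n)) = refl

L-term-pascal : ∀ h y a n j →
  L-term h y a (suc n) (suc j) ≡ y * L-term h y a n (suc j) + h * L-term h y (σ a) n j
L-term-pascal h y a n j = begin
  + (suc n C suc j) * (h * h ^ j) * y ^ (n ∸ j) * a (suc j)
    ≡⟨ cong (λ c → + c * (h * h ^ j) * y ^ (n ∸ j) * a (suc j)) (nCk+nC[k+1]≡[n+1]C[k+1] n j) ⟨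
  (+ (n C j) + + (n C suc j)) * (h * h ^ j) * y ^ (n ∸ j) * a (suc j)
    ≡⟨ split (+ (n C j)) (+ (n C suc j)) h (h ^ j) (y ^ (n ∸ j)) (a (suc j)) ⟩
  h * (+ (n C j) * h ^ j * y ^ (n ∸ j) * a (suc j)) + + (n C suc j) * y ^ (n ∸ j) * (h * h ^ j * a (suc j))
    ≡⟨ cong (λ z → h * L-term h y (σ a) n j + z * (h * h ^ j * a (suc j))) (C-suc-*-^∸ n j y) ⟩
  h * L-term h y (σ a) n j + + (n C suc j) * (y * y ^ (n ∸ suc j)) * (h * h ^ j * a (suc j))
    ≡⟨ merge (h * L-term h y (σ a) n j) (+ (n C suc j)) y (y ^ (n ∸ suc j)) (h * h ^ j) (a (suc j)) ⟩
  y * L-term h y a n (suc j) + h * L-term h y (σ a) n j ∎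
  where
  split : ∀ c₀ c₁ h p Y a → (c₀ + c₁) * (h * p) * Y * a ≡ h * (c₀ * p * Y * a) + c₁ * Y * (h * p * a)
  split = solve-∀
  merge : ∀ R c y Y hp a → R + c * (y * Y) * (hp * a) ≡ y * (c * hp * Y * a) + R
  merge = solve-∀

L-suc : ∀ h y a n → L h y a (suc n) ≡ y * L h y a n + h * L h y (σ a) n
L-suc h y a n = begin
  L h y a (suc n)
    ≡⟨ sumTo-suc n (L-term h y a (suc n)) ⟩
  L-term h y a (suc n) 0 + sumTo n (L-term h y a (suc n) ∘ suc)
    ≡⟨ cong₂ _+_ (pull-y y (y ^ n) (a 0)) (sumTo-cong n (L-term-pascal h y a n)) ⟩
  y * G 0 + sumTo n (λ j → y * G (suc j) + h * L-term h y (σ a) n j)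
    ≡⟨ cong (_+_ (y * G 0)) (sumTo-+ n (λ j → y * G (suc j)) (λ j → h * L-term h y (σ a) n j)) ⟩
  y * G 0 + (sumTo n (λ j → y * G (suc j)) + sumTo n (λ j → h * L-term h y (σ a) n j))
    ≡⟨ cong₂ (λ u v → y * G 0 + (u + v)) (sumTo-* n y (G ∘ suc)) (sumTo-* n h (L-term h y (σ a) n)) ⟩
  y * G 0 + (y * sumTo n (G ∘ suc) + h * L h y (σ a) n)
    ≡⟨ factor-y y (G 0) (sumTo n (G ∘ suc)) (h * L h y (σ a) n) ⟩
  y * (G 0 + sumTo n (G ∘ suc)) + h * L h y (σ a) n
    ≡⟨ cong (λ s → y * s + h * L h y (σ a) n) (sumTo-suc n G) ⟨
  y * (sumTo n G + G (suc n)) + h * L h y (σ a) n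
    ≡⟨ cong (λ s → y * s + h * L h y (σ a) n) (trans (cong (_+_ (sumTo n G)) G[suc-n]≡0) (+-identityʳ (sumTo n G))) ⟩
  y * L h y a n + h * L h y (σ a) n ∎
  where
  G = L-term h y a n
  G[suc-n]≡0 : G (suc n) ≡ 0ℤ
  G[suc-n]≡0 rewrite k>n⇒nCk≡0 (ℕ.n<1+n n) = refl
  pull-y : ∀ y Y a → + 1 * 1ℤ * (y * Y) * a ≡ y * (+ 1 * 1ℤ * Y * a)
  pull-y = solve-∀
  factor-y : ∀ y g s t → y * g + (y * s + t) ≡ y * (g + s) + t
  factor-y = solve-∀

-- On generating functions θ is the Euler operator x d/dx.
θ : (ℕ → ℤ) → ℕ → ℤ
θ a k = + k * a k

L-θ-suc : ∀ h y a n → L h y (θ a) (suc n) ≡ h * (+ suc n * L h y (σ a) n)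
L-θ-suc h y a n = begin
  L h y (θ a) (suc n)
    ≡⟨ sumTo-suc n (L-term h y (θ a) (suc n)) ⟩
  L-term h y (θ a) (suc n) 0 + sumTo n (L-term h y (θ a) (suc n) ∘ suc)
    ≡⟨ cong (_+ sumTo n (L-term h y (θ a) (suc n) ∘ suc)) (*-zeroʳ (+ 1 * 1ℤ * y ^ suc n)) ⟩
  0ℤ + sumTo n (L-term h y (θ a) (suc n) ∘ suc)
    ≡⟨ +-identityˡ (sumTo n (L-term h y (θ a) (suc n) ∘ suc)) ⟩
  sumTo n (L-term h y (θ a) (suc n) ∘ suc)
    ≡⟨ sumTo-cong n term-absorb ⟩
  sumTo n (λ j → h * (+ suc n * L-term h y (σ a) n j))
    ≡⟨ sumTo-* n h (λ j → + suc n * L-term h y (σ a) n j) ⟩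
  h * sumTo n (λ j → + suc n * L-term h y (σ a) n j)
    ≡⟨ cong (h *_) (sumTo-* n (+ suc n) (L-term h y (σ a) n)) ⟩
  h * (+ suc n * L h y (σ a) n) ∎
  where
  absorb : ∀ j → + suc j * + (suc n C suc j) ≡ + suc n * + (n C j)
  absorb j = trans (sym (pos-* (suc j) (suc n C suc j))) (trans (cong +_ (C-absorb n j)) (pos-* (suc n) (n C j)))
  regroup : ∀ c h p Y s a → c * (h * p) * Y * (s * a) ≡ h * (s * c * (p * Y * a))
  regroup = solve-∀
  unfold : ∀ t d p Y a → h * (t * d * (p * Y * a)) ≡ h * (t * (d * p * Y * a))
  unfold = solve-∀
  term-absorb : ∀ j → L-term h y (θ a) (suc n) (suc j) ≡ h * (+ suc n * L-term h y (σ a) n j)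
  term-absorb j = begin
    + (suc n C suc j) * (h * h ^ j) * y ^ (n ∸ j) * (+ suc j * a (suc j))
      ≡⟨ regroup (+ (suc n C suc j)) h (h ^ j) (y ^ (n ∸ j)) (+ suc j) (a (suc j)) ⟩
    h * (+ suc j * + (suc n C suc j) * (h ^ j * y ^ (n ∸ j) * a (suc j)))
      ≡⟨ cong (λ c → h * (c * (h ^ j * y ^ (n ∸ j) * a (suc j)))) (absorb j) ⟩
    h * (+ suc n * + (n C j) * (h ^ j * y ^ (n ∸ j) * a (suc j)))
      ≡⟨ unfold (+ suc n) (+ (n C j)) (h ^ j) (y ^ (n ∸ j)) (a (suc j)) ⟩
    h * (+ suc n * L-term h y (σ a) n j) ∎

Λ : (ℕ → ℤ) → ℕ → ℤ
Λ = L -[1+ 0 ] (+ 4)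

ShiftedCatalanRecurrence : (ℕ → ℤ) → Set
ShiftedCatalanRecurrence a = ∀ k → (+ 3 + + k) * a (suc k) ≡ (+ 6 + + 4 * + k) * a k

σcatalan-recurrence : ShiftedCatalanRecurrence (σ catalanℤ)
σcatalan-recurrence k = begin
  (+ 3 + + k) * catalanℤ (2 ℕ.+ k)              ≡⟨ pos-* (3 ℕ.+ k) (catalan (2 ℕ.+ k)) ⟨
  + ((3 ℕ.+ k) ℕ.* catalan (2 ℕ.+ k))           ≡⟨ cong +_ (catalan-suc (suc k)) ⟩
  + ((2 ℕ.+ 4 ℕ.* suc k) ℕ.* catalan (suc k))   ≡⟨ pos-* (2 ℕ.+ 4 ℕ.* suc k) (catalan (suc k)) ⟩
  + (2 ℕ.+ 4 ℕ.* suc k) * catalanℤ (suc k)      ≡⟨ cong (λ m → + m * catalanℤ (suc k)) (coefficient k) ⟩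
  + (6 ℕ.+ 4 ℕ.* k) * catalanℤ (suc k)          ≡⟨ cong (λ i → (+ 6 + i) * catalanℤ (suc k)) (pos-* 4 k) ⟩
  (+ 6 + + 4 * + k) * catalanℤ (suc k)          ∎
  where
  coefficient : ∀ k → 2 ℕ.+ 4 ℕ.* suc k ≡ 6 ℕ.+ 4 ℕ.* k
  coefficient = ℕ-Solver.solve-∀

Λ-θ-recurrence : ∀ {a} → ShiftedCatalanRecurrence a →
  ∀ n → Λ (θ (σ a)) n + + 3 * Λ (σ a) n ≡ + 4 * Λ (θ a) n + + 6 * Λ a n
Λ-θ-recurrence {a} rec n = begin
  Λ (θ (σ a)) n + + 3 * Λ (σ a) n
    ≡⟨ cong (_+_ (Λ (θ (σ a)) n)) (L-* -[1+ 0 ] (+ 4) (+ 3) (σ a) n) ⟨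
  Λ (θ (σ a)) n + Λ (λ k → + 3 * σ a k) n
    ≡⟨ L-+ -[1+ 0 ] (+ 4) (θ (σ a)) (λ k → + 3 * σ a k) n ⟨
  Λ (λ k → θ (σ a) k + + 3 * σ a k) n
    ≡⟨ L-cong -[1+ 0 ] (+ 4) n rec-θ ⟩
  Λ (λ k → + 4 * θ a k + + 6 * a k) n
    ≡⟨ L-+ -[1+ 0 ] (+ 4) (λ k → + 4 * θ a k) (λ k → + 6 * a k) n ⟩
  Λ (λ k → + 4 * θ a k) n + Λ (λ k → + 6 * a k) n
    ≡⟨ cong₂ _+_ (L-* -[1+ 0 ] (+ 4) (+ 4) (θ a) n) (L-* -[1+ 0 ] (+ 4) (+ 6) a n) ⟩
  + 4 * Λ (θ a) n + + 6 * Λ a n ∎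
  where
  collect : ∀ K x → K * x + + 3 * x ≡ (+ 3 + K) * x
  collect = solve-∀
  expand : ∀ K x → (+ 6 + + 4 * K) * x ≡ + 4 * (K * x) + + 6 * x
  expand = solve-∀
  rec-θ : ∀ k → θ (σ a) k + + 3 * σ a k ≡ + 4 * θ a k + + 6 * a k
  rec-θ k = trans (collect (+ k) (a (suc k))) (trans (rec k) (expand (+ k) (a k)))

Λ-σ-ratio : ∀ {a} → ShiftedCatalanRecurrence a → ∀ n → (+ 3 + + n) * Λ (σ a) n ≡ + 6 * Λ a n
Λ-σ-ratio {a} rec zero =
  -- Λ (θ b) 0 computes to 0ℤ.
  trans (sym (+-identityˡ (+ 3 * Λ (σ a) 0))) (trans (Λ-θ-recurrence rec 0) (+-identityˡ (+ 6 * Λ a 0)))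
Λ-σ-ratio {a} rec (suc m) = begin
  (+ 3 + K) * τ′                                ≡⟨ split K τ′ ⟩
  + 3 * τ′ + K * τ′                             ≡⟨ cong (λ t → + 3 * τ′ + K * t) (L-suc -[1+ 0 ] (+ 4) (σ a) m) ⟩
  + 3 * τ′ + K * (+ 4 * τ + -[1+ 0 ] * τ₂)      ≡⟨ regroup K τ τ₂ τ′ ⟩
  -[1+ 0 ] * (K * τ₂) + + 3 * τ′ + + 4 * (K * τ) ≡⟨ cong (_+ + 4 * (K * τ)) θ-recurrence ⟩
  + 4 * (-[1+ 0 ] * (K * τ)) + + 6 * β′ + + 4 * (K * τ) ≡⟨ cancel K τ β′ ⟩
  + 6 * β′                                      ∎
  where
  K = + suc m
  τ = Λ (σ a) m
  τ′ = Λ (σ a) (suc m)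
  τ₂ = Λ (σ (σ a)) m
  β′ = Λ a (suc m)
  θ-recurrence : -[1+ 0 ] * (K * τ₂) + + 3 * τ′ ≡ + 4 * (-[1+ 0 ] * (K * τ)) + + 6 * β′
  θ-recurrence = begin
    -[1+ 0 ] * (K * τ₂) + + 3 * τ′       ≡⟨ cong (_+ + 3 * τ′) (L-θ-suc -[1+ 0 ] (+ 4) (σ a) m) ⟨
    Λ (θ (σ a)) (suc m) + + 3 * τ′        ≡⟨ Λ-θ-recurrence rec (suc m) ⟩
    + 4 * Λ (θ a) (suc m) + + 6 * β′      ≡⟨ cong (λ t → + 4 * t + + 6 * β′) (L-θ-suc -[1+ 0 ] (+ 4) a m) ⟩
    + 4 * (-[1+ 0 ] * (K * τ)) + + 6 * β′ ∎
  split : ∀ K t → (+ 3 + K) * t ≡ + 3 * t + K * t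
  split = solve-∀
  regroup : ∀ K τ τ₂ τ′ → + 3 * τ′ + K * (+ 4 * τ + -[1+ 0 ] * τ₂) ≡ -[1+ 0 ] * (K * τ₂) + + 3 * τ′ + + 4 * (K * τ)
  regroup = solve-∀
  cancel : ∀ K τ β → + 4 * (-[1+ 0 ] * (K * τ)) + + 6 * β + + 4 * (K * τ) ≡ + 6 * β
  cancel = solve-∀

Λ-preserves-recurrence : ∀ {a} → ShiftedCatalanRecurrence a → ShiftedCatalanRecurrence (Λ a)
Λ-preserves-recurrence {a} rec n = begin
  (+ 3 + + n) * Λ a (suc n)                              ≡⟨ cong ((+ 3 + + n) *_) (L-suc -[1+ 0 ] (+ 4) a n) ⟩
  (+ 3 + + n) * (+ 4 * Λ a n + -[1+ 0 ] * Λ (σ a) n)     ≡⟨ distrib (+ n) (Λ a n) (Λ (σ a) n) ⟩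
  + 4 * ((+ 3 + + n) * Λ a n) + -[1+ 0 ] * ((+ 3 + + n) * Λ (σ a) n)
    ≡⟨ cong (λ t → + 4 * ((+ 3 + + n) * Λ a n) + -[1+ 0 ] * t) (Λ-σ-ratio rec n) ⟩
  + 4 * ((+ 3 + + n) * Λ a n) + -[1+ 0 ] * (+ 6 * Λ a n) ≡⟨ collect (+ n) (Λ a n) ⟩
  (+ 6 + + 4 * + n) * Λ a n                              ∎
  where
  distrib : ∀ N β τ → (+ 3 + N) * (+ 4 * β + -[1+ 0 ] * τ) ≡ + 4 * ((+ 3 + N) * β) + -[1+ 0 ] * ((+ 3 + N) * τ)
  distrib = solve-∀
  collect : ∀ N β → + 4 * ((+ 3 + N) * β) + -[1+ 0 ] * (+ 6 * β) ≡ (+ 6 + + 4 * N) * β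
  collect = solve-∀

recurrence-unique : ∀ {a b} → ShiftedCatalanRecurrence a → ShiftedCatalanRecurrence b →
  a 0 ≡ b 0 → ∀ n → a n ≡ b n
recurrence-unique ra rb a₀≡b₀ zero    = a₀≡b₀
recurrence-unique {a} {b} ra rb a₀≡b₀ (suc n) = *-cancelˡ-≡ (+ 3 + + n) (a (suc n)) (b (suc n))
  (trans (ra n) (trans (cong ((+ 6 + + 4 * + n) *_) (recurrence-unique ra rb a₀≡b₀ n)) (sym (rb n))))

theorem17 : (n : ℕ) → L -[1+ 0 ] (+ 4) (σ catalanℤ) n ≡ σ catalanℤ n
theorem17 = recurrence-unique (Λ-preserves-recurrence σcatalan-recurrence) σcatalan-recurrence
  (L-zero -[1+ 0 ] (+ 4) (σ catalanℤ))
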